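{- For all integers $1\le k<n$, $$g_2(n,k)=\sum_{i=0}^{k-1}\binom{k}{i}\,g_3(n-k,k-i),$$ where $g_3(p,q)=0$ whenever $q>p$.
   Context: $C_r=\frac1{r+1}\binom{2r}{r}$ is the Catalan number. For $1\le k\le n$, $g_2(n,k)=\sum_{i_1+\cdots+i_k=n}C_{i_1-1}\cdots C_{i_k-1}$ and $g_3(n,k)=\sum_{i_1+\cdots+i_k=n}C_{i_1}\cdots C_{i_k}$, both sums over ordered $k$-tuples of positive integers. -}

module Defs where

open import Data.Nat using (ℕ; zero; suc; _+_; _*_; _∸_; _/_)
open import Data.Nat.Combinatorics using (_C_)
open import Data.List using (List; []; _∷_; map; length)
open import Data.Nat.ListAction using (sum; product)

catalan : ℕ → ℕ
catalan r = ((2 * r) C r) / suc r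

-- Comp n k : the list of all ordered k-tuples (as lists) of positive
-- integers summing to n, enumerated by the value of the first part.
-- Comp n 0 = [ [] ] if n = 0, else [].
mutual
  Comp : ℕ → ℕ → List (List ℕ)
  Comp zero    zero    = [] ∷ []
  Comp (suc n) zero    = []
  Comp n       (suc k) = firstPart n n k

  firstPart : ℕ → ℕ → ℕ → List (List ℕ)
  firstPart n zero    k = []
  firstPart n (suc m) k =
    map (suc m ∷_) (Comp (n ∸ suc m) k) Data.List.++ firstPart n m k

compSum : (ℕ → ℕ) → ℕ → ℕ → ℕ
compSum f n k = sum (map (λ t → product (map f t)) (Comp n k))

g₂ : ℕ → ℕ → ℕ
g₂ n k = compSum (λ i → catalan (i ∸ 1)) n k

-- g₃(n,k) = Σ C_{i₁}⋯C_{i_k}; automatically 0 when k > n (no such tuples)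
g₃ : ℕ → ℕ → ℕ
g₃ n k = compSum catalan n k

Σ< : ℕ → (ℕ → ℕ) → ℕ
Σ< zero    f = 0
Σ< (suc m) f = Σ< m f + f m

-- Let F(x) = Σ aᵢ xⁱ with a₀ = 1. Splitting off the first part of a composition shows that
-- A · k = compSum (a ∘ pred) · k has generating function (xF)ᵏ and B · i = compSum a · i has
-- generating function (F − 1)ⁱ. Hence (xF)ᵏ = xᵏ (1 + (F − 1))ᵏ = xᵏ Σᵢ (k C i) (F − 1)ⁱ, which is proved
-- coefficientwise by induction on k through Pascal's rule. For a = catalan the coefficient of
-- xⁿ is the identity, after the reindexing i ↦ k − i; the term i = k is g₃(n − k, 0) = 0.
module Submission where

open import Defs
open import Data.Nat using (ℕ; zero; suc; _+_; _*_; _∸_; _≤_; _<_; z≤n; s≤s; z<s)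
open import Data.Nat.Properties
open import Data.Nat.Combinatorics using (_C_; nCk≡nC[n∸k]; nCk+nC[k+1]≡[n+1]C[k+1]; k>n⇒nCk≡0)
open import Data.List using (List; []; _∷_; map; _++_)
open import Data.List.Properties using (map-++)
open import Data.Nat.ListAction using (sum; product)
open import Data.Nat.ListAction.Properties using (sum-++)
open import Data.Sum using (inj₁; inj₂)
open import Relation.Binary.PropositionalEquality
open import Algebra.Properties.CommutativeSemigroup +-commutativeSemigroup using (interchange)
open import Algebra.Properties.CommutativeSemigroup *-commutativeSemigroup using (x∙yz≈y∙xz)
open ≡-Reasoning

Σ<-cong : ∀ m {f g : ℕ → ℕ} → (∀ i → i < m → f i ≡ g i) → Σ< m f ≡ Σ< m g
Σ<-cong zero    f≡g = refl
Σ<-cong (suc m) f≡g = cong₂ _+_ (Σ<-cong m (λ i i<m → f≡g i (m<n⇒m<1+n i<m))) (f≡g m ≤-refl)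

Σ<-zero : ∀ m → Σ< m (λ _ → 0) ≡ 0
Σ<-zero zero    = refl
Σ<-zero (suc m) = cong (_+ 0) (Σ<-zero m)

Σ<-last-zero : ∀ m (f : ℕ → ℕ) → f m ≡ 0 → Σ< (suc m) f ≡ Σ< m f
Σ<-last-zero m f fm≡0 = trans (cong (Σ< m f +_) fm≡0) (+-identityʳ (Σ< m f))

Σ<-tail-zero : ∀ {n} m (f : ℕ → ℕ) → n ≤ m → (∀ j → n ≤ j → j < m → f j ≡ 0) → Σ< m f ≡ Σ< n f
Σ<-tail-zero zero    f z≤n _ = refl
Σ<-tail-zero {n} (suc m) f n≤1+m tail≡0 with m≤n⇒m<n∨m≡n n≤1+m
... | inj₂ refl = refl
... | inj₁ n<1+m = let n≤m = ≤-pred n<1+m in begin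
  Σ< (suc m) f ≡⟨ Σ<-last-zero m f (tail≡0 m n≤m ≤-refl) ⟩
  Σ< m f       ≡⟨ Σ<-tail-zero m f n≤m (λ j n≤j j<m → tail≡0 j n≤j (m<n⇒m<1+n j<m)) ⟩
  Σ< n f       ∎

Σ<-head : ∀ m (f : ℕ → ℕ) → Σ< (suc m) f ≡ f 0 + Σ< m (λ i → f (suc i))
Σ<-head zero    f = +-comm 0 (f 0)
Σ<-head (suc m) f = begin
  Σ< (suc m) f + f (suc m)                 ≡⟨ cong (_+ f (suc m)) (Σ<-head m f) ⟩
  f 0 + Σ< m (λ i → f (suc i)) + f (suc m) ≡⟨ +-assoc (f 0) _ _ ⟩
  f 0 + Σ< (suc m) (λ i → f (suc i))       ∎

Σ<-distrib-+ : ∀ m (f g : ℕ → ℕ) → Σ< m f + Σ< m g ≡ Σ< m (λ i → f i + g i)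
Σ<-distrib-+ zero    f g = refl
Σ<-distrib-+ (suc m) f g = trans (interchange (Σ< m f) (f m) (Σ< m g) (g m))
                                 (cong (_+ (f m + g m)) (Σ<-distrib-+ m f g))

*-distribˡ-Σ< : ∀ c m (f : ℕ → ℕ) → c * Σ< m f ≡ Σ< m (λ i → c * f i)
*-distribˡ-Σ< c zero    f = *-zeroʳ c
*-distribˡ-Σ< c (suc m) f = trans (*-distribˡ-+ c (Σ< m f) (f m)) (cong (_+ c * f m) (*-distribˡ-Σ< c m f))

Σ<-comm : ∀ m n (f : ℕ → ℕ → ℕ) → Σ< m (λ i → Σ< n (f i)) ≡ Σ< n (λ j → Σ< m (λ i → f i j))
Σ<-comm zero    n f = sym (Σ<-zero n)
Σ<-comm (suc m) n f = trans (cong (_+ Σ< n (f m)) (Σ<-comm m n f)) (Σ<-distrib-+ n _ (f m))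

Σ<-reverse : ∀ k (f : ℕ → ℕ) → Σ< (suc k) f ≡ Σ< (suc k) (λ i → f (k ∸ i))
Σ<-reverse zero    f = refl
Σ<-reverse (suc k) f = begin
  Σ< (suc (suc k)) f                          ≡⟨ Σ<-head (suc k) f ⟩
  f 0 + Σ< (suc k) (λ i → f (suc i))          ≡⟨ cong (f 0 +_) (Σ<-reverse k (λ i → f (suc i))) ⟩
  f 0 + Σ< (suc k) (λ i → f (suc (k ∸ i)))    ≡⟨ cong (f 0 +_) (Σ<-cong (suc k) 1+[k∸i]≡1+k∸i) ⟩
  f 0 + Σ< (suc k) (λ i → f (suc k ∸ i))      ≡⟨ +-comm (f 0) _ ⟩
  Σ< (suc k) (λ i → f (suc k ∸ i)) + f 0      ≡⟨ cong (λ x → Σ< (suc k) (λ i → f (suc k ∸ i)) + f x) (n∸n≡0 k) ⟨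
  Σ< (suc (suc k)) (λ i → f (suc k ∸ i))      ∎
  where
  1+[k∸i]≡1+k∸i : ∀ i → i < suc k → f (suc (k ∸ i)) ≡ f (suc k ∸ i)
  1+[k∸i]≡1+k∸i i i<1+k = cong f (sym (+-∸-assoc 1 (≤-pred i<1+k)))

Σ<-pascal : ∀ k (b : ℕ → ℕ) →
  Σ< (suc k) (λ i → (k C i) * b i) + Σ< (suc k) (λ i → (k C i) * b (suc i)) ≡
  Σ< (suc (suc k)) (λ i → (suc k C i) * b i)
Σ<-pascal k b = begin
  Σ< (suc k) (λ i → (k C i) * b i) + Q                     ≡⟨ cong (_+ Q) (Σ<-head k _) ⟩
  1 * b 0 + Σ< k (λ i → (k C suc i) * b (suc i)) + Q       ≡⟨ cong (λ x → 1 * b 0 + x + Q) (Σ<-last-zero k _ kC[1+k]≡0) ⟨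
  1 * b 0 + Σ< (suc k) (λ i → (k C suc i) * b (suc i)) + Q ≡⟨ +-assoc (1 * b 0) _ Q ⟩
  1 * b 0 + (Σ< (suc k) (λ i → (k C suc i) * b (suc i)) + Q)
    ≡⟨ cong (1 * b 0 +_) (Σ<-distrib-+ (suc k) _ _) ⟩
  1 * b 0 + Σ< (suc k) (λ i → (k C suc i) * b (suc i) + (k C i) * b (suc i))
    ≡⟨ cong (1 * b 0 +_) (Σ<-cong (suc k) (λ i _ → pascal i)) ⟩
  1 * b 0 + Σ< (suc k) (λ i → (suc k C suc i) * b (suc i)) ≡⟨ Σ<-head (suc k) _ ⟨
  Σ< (suc (suc k)) (λ i → (suc k C i) * b i)               ∎
  where
  Q = Σ< (suc k) (λ i → (k C i) * b (suc i))
  kC[1+k]≡0 : (k C suc k) * b (suc k) ≡ 0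
  kC[1+k]≡0 = cong (_* b (suc k)) (k>n⇒nCk≡0 (n<1+n k))
  pascal : ∀ i → (k C suc i) * b (suc i) + (k C i) * b (suc i) ≡ (suc k C suc i) * b (suc i)
  pascal i = trans (sym (*-distribʳ-+ (b (suc i)) (k C suc i) (k C i)))
                   (cong (_* b (suc i)) (trans (+-comm (k C suc i) (k C i)) (nCk+nC[k+1]≡[n+1]C[k+1] k i)))

sumProd : (ℕ → ℕ) → List (List ℕ) → ℕ
sumProd f ts = sum (map (λ t → product (map f t)) ts)

sumProd-++ : ∀ f ts us → sumProd f (ts ++ us) ≡ sumProd f ts + sumProd f us
sumProd-++ f ts us = trans (cong sum (map-++ _ ts us)) (sum-++ (map (λ t → product (map f t)) ts) _)

sumProd-map-∷ : ∀ f x ts → sumProd f (map (x ∷_) ts) ≡ f x * sumProd f ts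
sumProd-map-∷ f x []       = sym (*-zeroʳ (f x))
sumProd-map-∷ f x (t ∷ ts) = trans (cong (f x * product (map f t) +_) (sumProd-map-∷ f x ts))
                                   (sym (*-distribˡ-+ (f x) _ _))

sumProd-firstPart : ∀ f n m k →
  sumProd f (firstPart n m k) ≡ Σ< m (λ j → f (suc j) * compSum f (n ∸ suc j) k)
sumProd-firstPart f n zero    k = refl
sumProd-firstPart f n (suc m) k = begin
  sumProd f (map (suc m ∷_) (Comp (n ∸ suc m) k) ++ firstPart n m k)
    ≡⟨ sumProd-++ f (map (suc m ∷_) (Comp (n ∸ suc m) k)) (firstPart n m k) ⟩
  sumProd f (map (suc m ∷_) (Comp (n ∸ suc m) k)) + sumProd f (firstPart n m k)
    ≡⟨ cong₂ _+_ (sumProd-map-∷ f (suc m) (Comp (n ∸ suc m) k)) (sumProd-firstPart f n m k) ⟩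
  f (suc m) * compSum f (n ∸ suc m) k + Σ< m (λ j → f (suc j) * compSum f (n ∸ suc j) k)
    ≡⟨ +-comm (f (suc m) * compSum f (n ∸ suc m) k) _ ⟩
  Σ< (suc m) (λ j → f (suc j) * compSum f (n ∸ suc j) k) ∎

compSum-suc : ∀ f n k → compSum f n (suc k) ≡ Σ< n (λ j → f (suc j) * compSum f (n ∸ suc j) k)
compSum-suc f zero    k = refl
compSum-suc f (suc n) k = sumProd-firstPart f (suc n) (suc n) k

compSum-zero-parts : ∀ f g n → compSum f n 0 ≡ compSum g n 0
compSum-zero-parts f g zero    = refl
compSum-zero-parts f g (suc n) = refl

compSum-positive-zero-parts : ∀ f {m} → 0 < m → compSum f m 0 ≡ 0
compSum-positive-zero-parts f {suc m} _ = refl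

compSum-< : ∀ f {m} k → m < k → compSum f m k ≡ 0
compSum-< f {m} (suc k) m<1+k = begin
  compSum f m (suc k)                                     ≡⟨ compSum-suc f m k ⟩
  Σ< m (λ j → f (suc j) * compSum f (m ∸ suc j) k)        ≡⟨ Σ<-cong m (λ j j<m → cong (f (suc j) *_) (rest<k j<m)) ⟩
  Σ< m (λ j → f (suc j) * 0)                              ≡⟨ Σ<-cong m (λ j _ → *-zeroʳ (f (suc j))) ⟩
  Σ< m (λ _ → 0)                                          ≡⟨ Σ<-zero m ⟩
  0                                                       ∎
  where
  rest<k : ∀ {j} → j < m → compSum f (m ∸ suc j) k ≡ 0
  rest<k j<m = compSum-< f k (<-≤-trans (∸-monoʳ-< {o = 0} z<s j<m) (≤-pred m<1+k))

module BinomialExpansion (a : ℕ → ℕ) (a₀≡1 : a 0 ≡ 1) where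

  A B : ℕ → ℕ → ℕ
  A = compSum (λ i → a (i ∸ 1))
  B = compSum a

  A-suc : ∀ n k → A (suc k + n) (suc k) ≡ Σ< (suc n) (λ j → a j * A (k + n ∸ j) k)
  A-suc n k = begin
    A (suc k + n) (suc k)                               ≡⟨ compSum-suc _ (suc k + n) k ⟩
    Σ< (suc k + n) term                                 ≡⟨ Σ<-tail-zero (suc k + n) term 1+n≤1+k+n term≡0 ⟩
    Σ< (suc n) term                                     ∎
    where
    term : ℕ → ℕ
    term j = a j * A (k + n ∸ j) k
    1+n≤1+k+n : suc n ≤ suc k + n
    1+n≤1+k+n = s≤s (m≤n+m n k)
    k+n∸j<k : ∀ {j} → n < j → j ≤ k + n → k + n ∸ j < k
    k+n∸j<k {j} n<j j≤k+n = subst (k + n ∸ j <_) (m+n∸n≡m k n) (∸-monoʳ-< n<j j≤k+n)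
    term≡0 : ∀ j → suc n ≤ j → j < suc k + n → term j ≡ 0
    term≡0 j n<j j<1+k+n =
      trans (cong (a j *_) (compSum-< _ k (k+n∸j<k n<j (≤-pred j<1+k+n)))) (*-zeroʳ (a j))

  Σ<-weighted-B-suc : ∀ n m (c : ℕ → ℕ) →
    Σ< n (λ j → a (suc j) * Σ< m (λ i → c i * B (n ∸ suc j) i)) ≡ Σ< m (λ i → c i * B n (suc i))
  Σ<-weighted-B-suc n m c = begin
    Σ< n (λ j → a (suc j) * Σ< m (λ i → c i * B (n ∸ suc j) i))
      ≡⟨ Σ<-cong n (λ j _ → trans (*-distribˡ-Σ< (a (suc j)) m _)
                                  (Σ<-cong m (λ i _ → x∙yz≈y∙xz (a (suc j)) (c i) _))) ⟩
    Σ< n (λ j → Σ< m (λ i → c i * (a (suc j) * B (n ∸ suc j) i)))  ≡⟨ Σ<-comm n m _ ⟩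
    Σ< m (λ i → Σ< n (λ j → c i * (a (suc j) * B (n ∸ suc j) i)))
      ≡⟨ Σ<-cong m (λ i _ → trans (sym (*-distribˡ-Σ< (c i) n _))
                                  (cong (c i *_) (sym (compSum-suc a n i)))) ⟩
    Σ< m (λ i → c i * B n (suc i)) ∎

  A≡Σ<-binomial-B : ∀ k n → A (k + n) k ≡ Σ< (suc k) (λ i → (k C i) * B n i)
  A≡Σ<-binomial-B zero    n = trans (compSum-zero-parts _ a n) (sym (*-identityˡ _))
  A≡Σ<-binomial-B (suc k) n = begin
    A (suc k + n) (suc k)                                           ≡⟨ A-suc n k ⟩
    Σ< (suc n) (λ j → a j * A (k + n ∸ j) k)                        ≡⟨ Σ<-head n _ ⟩
    a 0 * A (k + n) k + Σ< n (λ j → a (suc j) * A (k + n ∸ suc j) k)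
      ≡⟨ cong₂ _+_ (trans (cong (_* A (k + n) k) a₀≡1) (*-identityˡ _))
                   (Σ<-cong n (λ j j<n → cong (a (suc j) *_) (shift j<n))) ⟩
    A (k + n) k + Σ< n (λ j → a (suc j) * A (k + (n ∸ suc j)) k)
      ≡⟨ cong₂ _+_ (A≡Σ<-binomial-B k n)
                   (Σ<-cong n (λ j _ → cong (a (suc j) *_) (A≡Σ<-binomial-B k (n ∸ suc j)))) ⟩
    Σ< (suc k) (λ i → (k C i) * B n i)
      + Σ< n (λ j → a (suc j) * Σ< (suc k) (λ i → (k C i) * B (n ∸ suc j) i))
      ≡⟨ cong (Σ< (suc k) (λ i → (k C i) * B n i) +_) (Σ<-weighted-B-suc n (suc k) (k C_)) ⟩
    Σ< (suc k) (λ i → (k C i) * B n i) + Σ< (suc k) (λ i → (k C i) * B n (suc i))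
      ≡⟨ Σ<-pascal k (B n) ⟩
    Σ< (suc (suc k)) (λ i → (suc k C i) * B n i) ∎
    where
    shift : ∀ {j} → j < n → A (k + n ∸ suc j) k ≡ A (k + (n ∸ suc j)) k
    shift j<n = cong (λ x → A x k) (+-∸-assoc k j<n)

open BinomialExpansion catalan refl

mainTheorem14 : (n k : ℕ) → 1 ≤ k → k < n →
    g₂ n k ≡ Σ< k (λ i → (k C i) * g₃ (n ∸ k) (k ∸ i))
mainTheorem14 n k _ k<n = begin
  g₂ n k                                            ≡⟨ cong (λ x → A x k) (m+[n∸m]≡n (<⇒≤ k<n)) ⟨
  A (k + m) k                                       ≡⟨ A≡Σ<-binomial-B k m ⟩
  Σ< (suc k) (λ i → (k C i) * B m i)                ≡⟨ Σ<-reverse k _ ⟩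
  Σ< (suc k) (λ i → (k C (k ∸ i)) * B m (k ∸ i))    ≡⟨ Σ<-cong (suc k) symmetry ⟩
  Σ< (suc k) (λ i → (k C i) * B m (k ∸ i))          ≡⟨ Σ<-last-zero k _ no-parts ⟩
  Σ< k (λ i → (k C i) * g₃ m (k ∸ i))               ∎
  where
  m = n ∸ k
  symmetry : ∀ i → i < suc k → (k C (k ∸ i)) * B m (k ∸ i) ≡ (k C i) * B m (k ∸ i)
  symmetry i i≤k = cong (_* B m (k ∸ i)) (sym (nCk≡nC[n∸k] (≤-pred i≤k)))
  no-parts : (k C k) * B m (k ∸ k) ≡ 0
  no-parts = begin
    (k C k) * B m (k ∸ k) ≡⟨ cong (λ x → (k C k) * B m x) (n∸n≡0 k) ⟩
    (k C k) * B m 0       ≡⟨ cong ((k C k) *_) (compSum-positive-zero-parts catalan (m<n⇒0<n∸m k<n)) ⟩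
    (k C k) * 0           ≡⟨ *-zeroʳ (k C k) ⟩
    0                     ∎
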